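{- The minimal rank preserving direct product $\underline{\times}$ of hypergraphs is associative: for all hypergraphs $H_1=(V_1,E_1)$, $H_2=(V_2,E_2)$, $H_3=(V_3,E_3)$, the map $(x,(y,z))\mapsto((x,y),z)$ is an isomorphism from $H_1\,\underline{\times}\,(H_2\,\underline{\times}\,H_3)$ to $(H_1\,\underline{\times}\,H_2)\,\underline{\times}\,H_3$; in particular these hypergraphs are isomorphic.
   Context: A (finite) hypergraph $H=(V,E)$ consists of a finite vertex set $V$ and a collection $E$ of non-empty subsets of $V$. An isomorphism is a bijection on vertices which, together with its inverse, maps edges to edges. For hypergraphs $H_1=(V_1,E_1)$, $H_2=(V_2,E_2)$, the minimal rank preserving direct product $H_1\,\underline{\times}\,H_2$ has vertex set $V_1\times V_2$; for $e_1\in E_1,e_2\in E_2$ let $r^{ - }_{e_1,e_2}=\min\{|e_1|,|e_2|\}$; its edges are all subsets $e\subseteq e_1\times e_2$ with $e_1\in E_1$, $e_2\in E_2$, $|e|=r^{ - }_{e_1,e_2}$ and $|p_i(e)|=r^{ - }_{e_1,e_2}$ for $i=1,2$, where $p_i$ is the projection to the $i$-th coordinate (i.e. both projections restricted to $e$ are injective and at least one maps onto $e_i$). -}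

module Defs where

open import Level using (0ℓ)
open import Data.Bool using (Bool; true; false; _∨_)
open import Data.Nat using (ℕ; zero; suc; _⊓_; _*_)
open import Data.Fin using (Fin; zero; suc)
open import Data.Fin.Properties using (*↔×)
open import Data.Fin.Subset using (∣_∣)
open import Data.Vec using (tabulate)
open import Data.Product using (Σ; ∃; _×_; _,_)
open import Data.Product.Function.NonDependent.Propositional using (_×-↔_)
open import Function using (_∘_; _↔_; Inverse)
open import Function.Properties.Inverse using (↔-trans)
open import Relation.Binary.PropositionalEquality using (_≡_)

-- The vertex set V is a type together with an
-- enumeration Fin n ↔ V (this is what "finite" means here).  Subsets of V
-- are represented by characteristic functions V → Bool (every subset of a
-- finite set is decidable).  The edge collection E is a predicate on
-- subsets: Edge e means "e ∈ E".
record Hypergraph : Set₁ where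
  field
    V    : Set
    size : ℕ
    enum : Fin size ↔ V
    Edge : (V → Bool) → Set

  card : (V → Bool) → ℕ
  card e = ∣ tabulate (λ i → e (Inverse.to enum i)) ∣

open Hypergraph public

-- Well-formedness of a hypergraph: E is a collection of subsets (membership
-- only depends on the subset, i.e. is invariant under pointwise equality of
-- characteristic functions) and every edge is non-empty.
record IsHypergraph (H : Hypergraph) : Set₁ where
  field
    edge-ext      : ∀ {e e′ : V H → Bool} → (∀ v → e v ≡ e′ v) → Edge H e → Edge H e′
    edge-nonempty : ∀ {e : V H → Bool} → Edge H e → ∃ λ v → e v ≡ true

anyFin : ∀ {n} → (Fin n → Bool) → Bool
anyFin {zero}  f = false
anyFin {suc n} f = f zero ∨ anyFin (f ∘ suc)

proj₁-img : (H₁ H₂ : Hypergraph) → (V H₁ × V H₂ → Bool) → V H₁ → Bool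
proj₁-img H₁ H₂ e x = anyFin (λ j → e (x , Inverse.to (enum H₂) j))

proj₂-img : (H₁ H₂ : Hypergraph) → (V H₁ × V H₂ → Bool) → V H₂ → Bool
proj₂-img H₁ H₂ e y = anyFin (λ i → e (Inverse.to (enum H₁) i , y))

_×̲_ : Hypergraph → Hypergraph → Hypergraph
H₁ ×̲ H₂ = record
  { V    = V H₁ × V H₂
  ; size = size H₁ * size H₂
  ; enum = ↔-trans *↔× (enum H₁ ×-↔ enum H₂)
  ; Edge = ProdEdge
  }
  where
  card₁₂ : (V H₁ × V H₂ → Bool) → ℕ
  card₁₂ e = ∣ tabulate (λ i → e (Inverse.to (↔-trans *↔× (enum H₁ ×-↔ enum H₂)) i)) ∣

  ProdEdge : (V H₁ × V H₂ → Bool) → Set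
  ProdEdge e =
    Σ (V H₁ → Bool) λ e₁ → Σ (V H₂ → Bool) λ e₂ →
      Edge H₁ e₁ × Edge H₂ e₂ ×
      (∀ x y → e (x , y) ≡ true → (e₁ x ≡ true × e₂ y ≡ true)) ×
      card₁₂ e ≡ card H₁ e₁ ⊓ card H₂ e₂ ×
      card H₁ (proj₁-img H₁ H₂ e) ≡ card H₁ e₁ ⊓ card H₂ e₂ ×
      card H₂ (proj₂-img H₁ H₂ e) ≡ card H₁ e₁ ⊓ card H₂ e₂

infixl 7 _×̲_

-- The image
-- of a subset e under f has characteristic function e ∘ f⁻¹.
record IsIsomorphism (H H′ : Hypergraph) (f : V H → V H′) : Set where
  field
    f⁻¹      : V H′ → V H
    inverseˡ : ∀ x → f⁻¹ (f x) ≡ x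
    inverseʳ : ∀ y → f (f⁻¹ y) ≡ y
    edge-to   : ∀ (e : V H → Bool) → Edge H e → Edge H′ (e ∘ f⁻¹)
    edge-from : ∀ (e : V H′ → Bool) → Edge H′ e → Edge H (e ∘ f)

assoc : {A B C : Set} → A × (B × C) → (A × B) × C
assoc (x , (y , z)) = ((x , y) , z)

-- An edge of H₁ ×̲ H₂ is exactly a maximum matching between an
-- edge e₁ of H₁ and an edge e₂ of H₂: a set of pairs in e₁ × e₂ on which both
-- projections are injective, of size min(|e₁|, |e₂|); the cardinality
-- conditions of the definition force the injectivity by pigeonhole.  For an
-- edge e ⊆ e₁ × e₂₃ of H₁ ×̲ (H₂ ×̲ H₃), viewed as a set of triples, each
-- coordinate determines the other two, so its projection M to V₁ × V₂ is a
-- matching between e₁ and e₂ of size min(|e₁|, |e₂|, |e₃|).  Adding pairs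
-- greedily extends M to a maximum matching F between e₁ and e₂, an edge of
-- H₁ ×̲ H₂, and the regrouped e is then a maximum matching between F and e₃.
-- The inverse direction is the mirror image.
module Submission where

open import Defs
open import Level using (0ℓ)
open import Data.Bool using (Bool; true; false; _∨_)
import Data.Bool.Properties as Bool
open import Data.Nat using (ℕ; zero; suc; _⊓_; _+_; _∸_; _≤_; _<_)
open import Data.Nat.Properties
  using (≤-trans; ≤-reflexive; <-≤-trans; n≤1+n; <-irrefl; <⇒≱; ⊓-assoc; m⊓n≤m; m⊓n≤n; m∸n+n≡m)
open import Data.Fin using (Fin; zero; suc; punchOut)
open import Data.Fin.Properties
  using (injective⇒≤; any?; all?; ¬∀⟶∃¬; punchOut-injective; cantor-schröder-bernstein)
  renaming (_≟_ to _≟ᶠ_)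
open import Data.Fin.Subset using (∣_∣)
open import Data.Vec using (tabulate)
open import Data.Product using (Σ; ∃; _×_; _,_; proj₁; proj₂; swap; assocʳ′)
import Data.Product as Product
open import Data.Product.Algebra using (×-comm; ×-assoc)
open import Data.Product.Properties using (≡-dec)
open import Data.Sum using (_⊎_; inj₁; inj₂; [_,_]′)
import Data.Sum as Sum
open import Data.Empty using (⊥-elim)
open import Function using (_∘_; id; _↔_; Inverse; mk↔ₛ′; Injective)
open import Function.Bundles using (Injection)
open import Function.Properties.Inverse using (↔-sym; ↔-trans; ↔⇒↣)
open import Relation.Binary.PropositionalEquality
open import Relation.Binary.Definitions using (DecidableEquality)
open import Relation.Nullary using (yes; no; does)
open import Relation.Nullary.Decidable using (dec-true; via-injection)
import Axiom.UniquenessOfIdentityProofs as UIP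

private
  variable
    A B X Y : Set
    m n : ℕ

open Inverse using (to; from; strictlyInverseˡ; strictlyInverseʳ)

to-injective : (β : X ↔ Y) → Injective _≡_ _≡_ (to β)
to-injective β = Injection.injective (↔⇒↣ β)

injective⇒surjective : {f : Fin n → Fin n} → Injective _≡_ _≡_ f → ∀ j → ∃ λ i → f i ≡ j
injective⇒surjective {suc n} {f} f-inj j with any? (λ i → f i ≟ᶠ j)
... | yes hit = hit
... | no miss = ⊥-elim (<-irrefl refl (injective⇒≤ skip-injective))
  where
  skip : Fin (suc n) → Fin n
  skip i = punchOut (λ j≡fi → miss (i , sym j≡fi))
  skip-injective : Injective _≡_ _≡_ skip
  skip-injective {i} {i′} =
    f-inj ∘ punchOut-injective (λ e → miss (i , sym e)) (λ e → miss (i′ , sym e))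

<⇒unreached : {f : Fin m → Fin n} → Injective _≡_ _≡_ f → m < n → ∃ λ j → ∀ i → f i ≢ j
<⇒unreached {m} {n} {f} f-inj m<n with all? (λ j → any? (λ i → f i ≟ᶠ j))
... | yes reached = ⊥-elim (<⇒≱ m<n (injective⇒≤ preimage-injective))
  where
  preimage-injective : Injective _≡_ _≡_ (proj₁ ∘ reached)
  preimage-injective {j} {j′} eq =
    trans (sym (proj₂ (reached j))) (trans (cong f eq) (proj₂ (reached j′)))
... | no ¬reached with ¬∀⟶∃¬ n _ (λ j → any? (λ i → f i ≟ᶠ j)) ¬reached
... | j , unreached = j , λ i fi≡j → unreached (i , fi≡j)

section⇒surjective : X ↔ Fin n → Y ↔ Fin n → (f : X → Y) (g : Y → X) →
  (∀ y → f (g y) ≡ y) → ∀ x → ∃ λ y → g y ≡ x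
section⇒surjective βX βY f g f∘g x
  with injective⇒surjective {f = to βX ∘ g ∘ from βY} ĝ-injective (to βX x)
  where
  ĝ-injective : Injective _≡_ _≡_ (to βX ∘ g ∘ from βY)
  ĝ-injective {i} {j} eq = begin
    i                         ≡⟨ strictlyInverseˡ βY i ⟨
    to βY (from βY i)         ≡⟨ cong (to βY) (f∘g (from βY i)) ⟨
    to βY (f (g (from βY i))) ≡⟨ cong (to βY ∘ f) (to-injective βX eq) ⟩
    to βY (f (g (from βY j))) ≡⟨ cong (to βY) (f∘g (from βY j)) ⟩
    to βY (from βY j)         ≡⟨ strictlyInverseˡ βY j ⟩
    j                         ∎
    where open ≡-Reasoning
... | j , eq = from βY j , to-injective βX eq

splitSurjection⇒injective : X ↔ Fin n → Y ↔ Fin n → (f : X → Y) (g : Y → X) →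
  (∀ y → f (g y) ≡ y) → Injective _≡_ _≡_ f
splitSurjection⇒injective βX βY f g f∘g {x} {x′} fx≡fx′
  with section⇒surjective βX βY f g f∘g x | section⇒surjective βX βY f g f∘g x′
... | y , refl | y′ , refl = cong g (trans (sym (f∘g y)) (trans fx≡fx′ (f∘g y′)))

Members : (X → Bool) → Set
Members {X} s = Σ X λ x → s x ≡ true

member-≡ : {s : X → Bool} {x y : X} {p : s x ≡ true} {q : s y ≡ true} →
  x ≡ y → _≡_ {A = Members s} (x , p) (y , q)
member-≡ {p = p} {q} refl = cong (_ ,_) (UIP.Decidable⇒UIP.≡-irrelevant Bool._≟_ p q)

_⊆_ : (X → Bool) → (X → Bool) → Set
s ⊆ t = ∀ {x} → s x ≡ true → t x ≡ true

HasSize : (X → Bool) → ℕ → Set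
HasSize s n = Members s ↔ Fin n

Members-∘ : (σ : X ↔ Y) (s : Y → Bool) → Members (s ∘ to σ) ↔ Members s
Members-∘ σ s = mk↔ₛ′ (Product.map (to σ) id) from′
  (λ (y , p) → member-≡ (strictlyInverseˡ σ y))
  (λ (x , p) → member-≡ (strictlyInverseʳ σ x))
  where
  from′ : Members s → Members (s ∘ to σ)
  from′ (y , p) = from σ y , subst (λ y → s y ≡ true) (sym (strictlyInverseˡ σ y)) p

hasSize-unique : {s : X → Bool} → HasSize s m → HasSize s n → m ≡ n
hasSize-unique βm βn = cantor-schröder-bernstein
  (to-injective (↔-trans (↔-sym βm) βn)) (to-injective (↔-trans (↔-sym βn) βm))

count↔ : (f : Fin n → Bool) → Members f ↔ Fin ∣ tabulate f ∣
count↔ {zero} f = mk↔ₛ′ (λ ()) (λ ()) (λ ()) (λ ())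
count↔ {suc n} f with f zero in f₀ | count↔ (f ∘ suc)
... | true | β = mk↔ₛ′ to′ from′ to∘from from∘to
  where
  to′ : Members f → Fin (suc ∣ tabulate (f ∘ suc) ∣)
  to′ (zero , _) = zero
  to′ (suc i , p) = suc (to β (i , p))
  from′ : Fin (suc ∣ tabulate (f ∘ suc) ∣) → Members f
  from′ zero = zero , f₀
  from′ (suc j) = Product.map suc id (from β j)
  to∘from : ∀ j → to′ (from′ j) ≡ j
  to∘from zero = refl
  to∘from (suc j) = cong suc (strictlyInverseˡ β j)
  from∘to : ∀ x → from′ (to′ x) ≡ x
  from∘to (zero , _) = member-≡ refl
  from∘to (suc i , p) = cong (Product.map suc id) (strictlyInverseʳ β (i , p))
... | false | β = mk↔ₛ′ to′ (Product.map suc id ∘ from β) (strictlyInverseˡ β) from∘to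
  where
  to′ : Members f → Fin ∣ tabulate (f ∘ suc) ∣
  to′ (zero , p) with () ← trans (sym f₀) p
  to′ (suc i , p) = to β (i , p)
  from∘to : ∀ x → Product.map suc id (from β (to′ x)) ≡ x
  from∘to (zero , p) with () ← trans (sym f₀) p
  from∘to (suc i , p) = cong (Product.map suc id) (strictlyInverseʳ β (i , p))

card-hasSize : (H : Hypergraph) (s : V H → Bool) → HasSize s (card H s)
card-hasSize H s = ↔-trans (↔-sym (Members-∘ (enum H) s)) (count↔ (s ∘ to (enum H)))

hasSize⇒card : (H : Hypergraph) {s : V H → Bool} → HasSize s n → card H s ≡ n
hasSize⇒card H {s} = hasSize-unique (card-hasSize H s)

card⇒hasSize : (H : Hypergraph) {s : V H → Bool} → card H s ≡ n → HasSize s n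
card⇒hasSize H {s} refl = card-hasSize H s

vertex-≟ : (H : Hypergraph) → DecidableEquality (V H)
vertex-≟ H = via-injection (↔⇒↣ (↔-sym (enum H))) _≟ᶠ_

anyFin⁺ : (f : Fin n → Bool) (i : Fin n) → f i ≡ true → anyFin f ≡ true
anyFin⁺ f zero    p rewrite p = refl
anyFin⁺ f (suc i) p rewrite anyFin⁺ (f ∘ suc) i p = Bool.∨-zeroʳ (f zero)

anyFin⁻ : (f : Fin n → Bool) → anyFin f ≡ true → ∃ λ i → f i ≡ true
anyFin⁻ {suc n} f p with f zero in f₀
... | true  = zero , f₀
... | false = Product.map suc id (anyFin⁻ (f ∘ suc) p)

-- Projections and matchings

Proj₁Injective : (A × B → Bool) → Set
Proj₁Injective R = ∀ {x y x′ y′} → R (x , y) ≡ true → R (x′ , y′) ≡ true → x ≡ x′ → y ≡ y′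

Proj₂Injective : (A × B → Bool) → Set
Proj₂Injective R = Proj₁Injective (R ∘ swap)

module _ {H₁ H₂ : Hypergraph} {R : V H₁ × V H₂ → Bool} where

  proj₁-img⁺ : ∀ {x y} → R (x , y) ≡ true → proj₁-img H₁ H₂ R x ≡ true
  proj₁-img⁺ {x} {y} p = anyFin⁺ _ (from (enum H₂) y)
    (subst (λ y → R (x , y) ≡ true) (sym (strictlyInverseˡ (enum H₂) y)) p)

  proj₁-img⁻ : ∀ {x} → proj₁-img H₁ H₂ R x ≡ true → ∃ λ y → R (x , y) ≡ true
  proj₁-img⁻ p = Product.map (to (enum H₂)) id (anyFin⁻ _ p)

  project₁ : Members R → Members (proj₁-img H₁ H₂ R)
  project₁ ((x , y) , p) = x , proj₁-img⁺ p

  section₁ : Members (proj₁-img H₁ H₂ R) → Members R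
  section₁ (x , p) = let (y , q) = proj₁-img⁻ p in (x , y) , q

  project₁∘section₁ : ∀ w → project₁ (section₁ w) ≡ w
  project₁∘section₁ _ = member-≡ refl

  proj₁-img↔ : Proj₁Injective R → Members R ↔ Members (proj₁-img H₁ H₂ R)
  proj₁-img↔ R-inj = mk↔ₛ′ project₁ section₁ project₁∘section₁
    λ ((x , y) , p) → member-≡ (cong (x ,_) (R-inj (proj₂ (proj₁-img⁻ (proj₁-img⁺ p))) p refl))

  proj₁Injective-bySize : HasSize R n → HasSize (proj₁-img H₁ H₂ R) n → Proj₁Injective R
  proj₁Injective-bySize βR βπ {x} {y} {x′} {y′} p p′ refl = cong (proj₂ ∘ proj₁)
    (splitSurjection⇒injective βR βπ project₁ section₁ project₁∘section₁
      {(x , y) , p} {(x , y′) , p′} (member-≡ refl))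

swap-↔ : (A × B) ↔ (B × A)
swap-↔ = ×-comm _ _

-- proj₂-img H₁ H₂ R is definitionally proj₁-img H₂ H₁ (R ∘ swap).
module _ {H₁ H₂ : Hypergraph} {R : V H₁ × V H₂ → Bool} where

  private
    Rᵀ : V H₂ × V H₁ → Bool
    Rᵀ = R ∘ swap

  proj₂-img⁺ : ∀ {x y} → R (x , y) ≡ true → proj₂-img H₁ H₂ R y ≡ true
  proj₂-img⁺ = proj₁-img⁺ {H₂} {H₁} {Rᵀ}

  proj₂-img⁻ : ∀ {y} → proj₂-img H₁ H₂ R y ≡ true → ∃ λ x → R (x , y) ≡ true
  proj₂-img⁻ = proj₁-img⁻ {H₂} {H₁} {Rᵀ}

  proj₂-img↔ : Proj₂Injective R → Members R ↔ Members (proj₂-img H₁ H₂ R)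
  proj₂-img↔ R-inj = ↔-trans (↔-sym (Members-∘ swap-↔ R)) (proj₁-img↔ {H₂} {H₁} {Rᵀ} R-inj)

  proj₂Injective-bySize : HasSize R n → HasSize (proj₂-img H₁ H₂ R) n → Proj₂Injective R
  proj₂Injective-bySize βR =
    proj₁Injective-bySize {H₂} {H₁} {Rᵀ} (↔-trans (Members-∘ swap-↔ R) βR)

record Matching (e₁ : A → Bool) (e₂ : B → Bool) (R : A × B → Bool) : Set where
  field
    within          : ∀ x y → R (x , y) ≡ true → e₁ x ≡ true × e₂ y ≡ true
    proj₁-injective : Proj₁Injective R
    proj₂-injective : Proj₂Injective R

open Matching

Matching-swap : {e₁ : A → Bool} {e₂ : B → Bool} {R : A × B → Bool} →
  Matching e₁ e₂ R → Matching e₂ e₁ (R ∘ swap)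
Matching-swap m = record
  { within          = λ y x p → swap (within m x y p)
  ; proj₁-injective = proj₂-injective m
  ; proj₂-injective = proj₁-injective m
  }

unmatched₁ : {e₁ : A → Bool} {e₂ : B → Bool} {M : A × B → Bool} {a r : ℕ} →
  Matching e₁ e₂ M → HasSize e₁ a → HasSize M r → r < a →
  ∃ λ x → e₁ x ≡ true × ∀ y → M (x , y) ≢ true
unmatched₁ {e₁ = e₁} {M = M} m βa βM r<a = proj₁ (from βa j) , proj₂ (from βa j) , free
  where
  endpoint : Members M → Members e₁
  endpoint ((x , y) , p) = x , proj₁ (within m x y p)

  endpoint-injective : Injective _≡_ _≡_ endpoint
  endpoint-injective {(x , y) , p} {(x′ , y′) , p′} eq with cong proj₁ eq
  ... | refl = member-≡ (cong (x ,_) (proj₁-injective m p p′ refl))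

  missed : ∃ λ j → ∀ i → to βa (endpoint (from βM i)) ≢ j
  missed = <⇒unreached {f = to βa ∘ endpoint ∘ from βM}
    (to-injective (↔-sym βM) ∘ endpoint-injective ∘ to-injective βa) r<a
  j : Fin _
  j = proj₁ missed

  free : ∀ y → M (proj₁ (from βa j) , y) ≢ true
  free y p = proj₂ missed (to βM (_ , p)) (begin
    to βa (endpoint (from βM (to βM (_ , p)))) ≡⟨ cong (to βa ∘ endpoint) (strictlyInverseʳ βM _) ⟩
    to βa (endpoint (_ , p))                  ≡⟨ cong (to βa) (member-≡ refl) ⟩
    to βa (from βa j)                         ≡⟨ strictlyInverseˡ βa j ⟩
    j                                         ∎)
    where open ≡-Reasoning

unmatched₂ : {e₁ : A → Bool} {e₂ : B → Bool} {M : A × B → Bool} {b r : ℕ} →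
  Matching e₁ e₂ M → HasSize e₂ b → HasSize M r → r < b →
  ∃ λ y → e₂ y ≡ true × ∀ x → M (x , y) ≢ true
unmatched₂ {M = M} m βb βM =
  unmatched₁ (Matching-swap m) βb (↔-trans (Members-∘ swap-↔ M) βM)

module _ (_≟_ : DecidableEquality X) (w : X) (s : X → Bool) where

  insert : X → Bool
  insert x = does (x ≟ w) ∨ s x

  insert⁻ : ∀ {x} → insert x ≡ true → x ≡ w ⊎ s x ≡ true
  insert⁻ {x} p with x ≟ w
  ... | yes x≡w = inj₁ x≡w
  ... | no _    = inj₂ p

  insert-here : insert w ≡ true
  insert-here = cong (_∨ s w) (dec-true (w ≟ w) refl)

  ⊆-insert : s ⊆ insert
  ⊆-insert {x} p = trans (cong (does (x ≟ w) ∨_) p) (Bool.∨-zeroʳ _)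

  insert-hasSize : s w ≢ true → HasSize s n → HasSize insert (suc n)
  insert-hasSize {n} w∉s β = mk↔ₛ′ to′ from′ to∘from from∘to
    where
    to′ : Members insert → Fin (suc n)
    to′ (x , p) with x ≟ w
    ... | yes _ = zero
    ... | no _  = suc (to β (x , p))

    from′ : Fin (suc n) → Members insert
    from′ zero    = w , insert-here
    from′ (suc i) = Product.map id ⊆-insert (from β i)

    -- Generalised over the membership proof so that `with _ ≟ w` is well-typed.
    to′-new : (p : insert w ≡ true) → to′ (w , p) ≡ zero
    to′-new p with w ≟ w
    ... | yes _   = refl
    ... | no w≢w = ⊥-elim (w≢w refl)

    to′-old : ∀ {x} (p : s x ≡ true) (q : insert x ≡ true) → to′ (x , q) ≡ suc (to β (x , p))
    to′-old {x} p q with x ≟ w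
    ... | yes refl = ⊥-elim (w∉s p)
    ... | no _     = cong suc (cong (to β) (member-≡ refl))

    to∘from : ∀ i → to′ (from′ i) ≡ i
    to∘from zero = to′-new insert-here
    to∘from (suc i) = trans (to′-old (proj₂ (from β i)) _) (cong suc (strictlyInverseˡ β i))

    to′-faithful : ∀ x p → proj₁ (from′ (to′ (x , p))) ≡ x
    to′-faithful x p with x ≟ w
    ... | yes refl = refl
    ... | no _     = cong proj₁ (strictlyInverseʳ β (x , p))

    from∘to : ∀ w′ → from′ (to′ w′) ≡ w′
    from∘to (x , p) = member-≡ (to′-faithful x p)

proj₁Injective-extend : {R M : A × B → Bool} {x : A} {y : B} →
  (∀ {v} → R v ≡ true → v ≡ (x , y) ⊎ M v ≡ true) → (∀ y′ → M (x , y′) ≢ true) →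
  Proj₁Injective M → Proj₁Injective R
proj₁Injective-extend R⊆ x-free M-inj p p′ refl with R⊆ p | R⊆ p′
... | inj₁ refl | inj₁ refl = refl
... | inj₁ refl | inj₂ q′   = ⊥-elim (x-free _ q′)
... | inj₂ q    | inj₁ refl = ⊥-elim (x-free _ q)
... | inj₂ q    | inj₂ q′   = M-inj q q′ refl

Matching-insert : (_≟_ : DecidableEquality (A × B)) {e₁ : A → Bool} {e₂ : B → Bool}
  {M : A × B → Bool} {x : A} {y : B} → Matching e₁ e₂ M → e₁ x ≡ true → e₂ y ≡ true →
  (∀ y′ → M (x , y′) ≢ true) → (∀ x′ → M (x′ , y) ≢ true) →
  Matching e₁ e₂ (insert _≟_ (x , y) M)
Matching-insert _≟_ {M = M} {x} {y} m x∈e₁ y∈e₂ x-free y-free = record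
  { within          = λ x′ y′ p →
      [ (λ { refl → x∈e₁ , y∈e₂ }) , within m x′ y′ ]′ (insert⁻ _≟_ _ M p)
  ; proj₁-injective = proj₁Injective-extend (insert⁻ _≟_ _ M) x-free (proj₁-injective m)
  ; proj₂-injective = proj₁Injective-extend (Sum.map₁ (cong swap) ∘ insert⁻ _≟_ _ M) y-free
                        (proj₂-injective m)
  }

module _ {e₁ : A → Bool} {e₂ : B → Bool} {a b : ℕ} (_≟₁_ : DecidableEquality A)
  (_≟₂_ : DecidableEquality B) (βa : HasSize e₁ a) (βb : HasSize e₂ b) where

  augment : {M : A × B → Bool} {r : ℕ} → Matching e₁ e₂ M → HasSize M r → r < a ⊓ b →
    ∃ λ F → Matching e₁ e₂ F × HasSize F (suc r) × M ⊆ F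
  augment {M} m βM r<a⊓b =
    let (x , x∈e₁ , x-free) = unmatched₁ m βa βM (<-≤-trans r<a⊓b (m⊓n≤m a b))
        (y , y∈e₂ , y-free) = unmatched₂ m βb βM (<-≤-trans r<a⊓b (m⊓n≤n a b))
    in insert _≟_ (x , y) M ,
       Matching-insert _≟_ m x∈e₁ y∈e₂ x-free y-free ,
       insert-hasSize _≟_ (x , y) M (x-free y) βM ,
       ⊆-insert _≟_ (x , y) M
    where
    _≟_ : DecidableEquality (A × B)
    _≟_ = ≡-dec _≟₁_ _≟₂_

  extend : ∀ d {M : A × B → Bool} {r : ℕ} → Matching e₁ e₂ M → HasSize M r → d + r ≤ a ⊓ b →
    ∃ λ F → Matching e₁ e₂ F × HasSize F (d + r) × M ⊆ F
  extend zero    {M} m βM _ = M , m , βM , id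
  extend (suc d) m βM d+r<a⊓b =
    let (F , mF , βF , M⊆F) = extend d m βM (≤-trans (n≤1+n _) d+r<a⊓b)
        (G , mG , βG , F⊆G) = augment mF βF d+r<a⊓b
    in G , mG , βG , F⊆G ∘ M⊆F

  extend-to-maximum : {M : A × B → Bool} {r : ℕ} → Matching e₁ e₂ M → HasSize M r → r ≤ a ⊓ b →
    ∃ λ F → Matching e₁ e₂ F × HasSize F (a ⊓ b) × M ⊆ F
  extend-to-maximum {r = r} m βM r≤a⊓b =
    subst (λ n → ∃ λ F → Matching e₁ e₂ F × HasSize F n × _ ⊆ F) (m∸n+n≡m r≤a⊓b)
      (extend (a ⊓ b ∸ r) m βM (≤-reflexive (m∸n+n≡m r≤a⊓b)))

-- Edges of a product

record MaximumMatching (H₁ H₂ : Hypergraph) (R : V H₁ × V H₂ → Bool) : Set where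
  field
    left       : V H₁ → Bool
    right      : V H₂ → Bool
    left-edge  : Edge H₁ left
    right-edge : Edge H₂ right
    matching   : Matching left right R
    maximum    : HasSize R (card H₁ left ⊓ card H₂ right)

module _ (H₁ H₂ : Hypergraph) {R : V H₁ × V H₂ → Bool} where

  edge⇒maximumMatching : Edge (H₁ ×̲ H₂) R → MaximumMatching H₁ H₂ R
  edge⇒maximumMatching (e₁ , e₂ , e₁-edge , e₂-edge , R⊆e₁×e₂ , |R| , |π₁R| , |π₂R|) = record
    { left       = e₁
    ; right      = e₂
    ; left-edge  = e₁-edge
    ; right-edge = e₂-edge
    ; matching   = record
      { within          = R⊆e₁×e₂
      ; proj₁-injective = proj₁Injective-bySize {H₁} {H₂} βR (card⇒hasSize H₁ |π₁R|)
      ; proj₂-injective = proj₂Injective-bySize {H₁} {H₂} βR (card⇒hasSize H₂ |π₂R|)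
      }
    ; maximum    = βR
    }
    where
    βR : HasSize R (card H₁ e₁ ⊓ card H₂ e₂)
    βR = card⇒hasSize (H₁ ×̲ H₂) |R|

  maximumMatching⇒edge : MaximumMatching H₁ H₂ R → Edge (H₁ ×̲ H₂) R
  maximumMatching⇒edge mm =
    left , right , left-edge , right-edge , within matching ,
    hasSize⇒card (H₁ ×̲ H₂) maximum ,
    hasSize⇒card H₁ (↔-trans (↔-sym (proj₁-img↔ {H₁} {H₂} (proj₁-injective matching))) maximum) ,
    hasSize⇒card H₂ (↔-trans (↔-sym (proj₂-img↔ {H₁} {H₂} (proj₂-injective matching))) maximum)
    where open MaximumMatching mm

matching-extends-to-edge : (H₁ H₂ : Hypergraph) {e₁ : V H₁ → Bool} {e₂ : V H₂ → Bool}
  {M : V H₁ × V H₂ → Bool} {r : ℕ} → Edge H₁ e₁ → Edge H₂ e₂ → Matching e₁ e₂ M →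
  HasSize M r → r ≤ card H₁ e₁ ⊓ card H₂ e₂ →
  ∃ λ F → Edge (H₁ ×̲ H₂) F × M ⊆ F × card (H₁ ×̲ H₂) F ≡ card H₁ e₁ ⊓ card H₂ e₂
matching-extends-to-edge H₁ H₂ {e₁} {e₂} e₁-edge e₂-edge m βM r≤ =
  let (F , F-matching , βF , M⊆F) = extend-to-maximum (vertex-≟ H₁) (vertex-≟ H₂)
                                      (card-hasSize H₁ e₁) (card-hasSize H₂ e₂) m βM r≤
  in F , maximumMatching⇒edge H₁ H₂ (record
           { left = e₁ ; right = e₂ ; left-edge = e₁-edge ; right-edge = e₂-edge
           ; matching = F-matching ; maximum = βF }) ,
     M⊆F , hasSize⇒card (H₁ ×̲ H₂) βF

module _ {C : Set} {e₁ : A → Bool} {e₂ : B → Bool} {e₃ : C → Bool}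
  {S : B × C → Bool} {R : A × (B × C) → Bool} (m : Matching e₁ S R) (mS : Matching e₂ e₃ S) where

  private
    inS : ∀ {x y z} → R (x , (y , z)) ≡ true → S (y , z) ≡ true
    inS p = proj₂ (within m _ _ p)

  assocʳ′-proj₁-injective : Proj₁Injective (R ∘ assocʳ′)
  assocʳ′-proj₁-injective p p′ refl = proj₁-injective mS (inS p) (inS p′) refl

  assocʳ′-proj₂-injective : Proj₂Injective (R ∘ assocʳ′)
  assocʳ′-proj₂-injective p p′ refl =
    let y≡y′ = proj₂-injective mS (inS p) (inS p′) refl
    in cong₂ _,_ (proj₂-injective m p p′ (cong₂ _,_ y≡y′ refl)) y≡y′

  assocʳ′-within : ∀ x y z → R (x , (y , z)) ≡ true → e₃ z ≡ true
  assocʳ′-within x y z p = proj₂ (within mS y z (inS p))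

  prefix-matching : {M : A × B → Bool} →
    (∀ {x y} → M (x , y) ≡ true → ∃ λ z → R (x , (y , z)) ≡ true) → Matching e₁ e₂ M
  prefix-matching M⁻ = record
    { within          = λ x y p → let (_ , q) = M⁻ p in
                          proj₁ (within m _ _ q) , proj₁ (within mS _ _ (inS q))
    ; proj₁-injective = λ p p′ x≡x′ → let (_ , q) = M⁻ p ; (_ , q′) = M⁻ p′ in
                          cong proj₁ (proj₁-injective m q q′ x≡x′)
    ; proj₂-injective = λ p p′ y≡y′ → let (_ , q) = M⁻ p ; (_ , q′) = M⁻ p′ in
                          proj₂-injective m q q′
                            (cong₂ _,_ y≡y′ (proj₁-injective mS (inS q) (inS q′) y≡y′))
    }

module _ {C : Set} {e₁ : A → Bool} {e₂ : B → Bool} {e₃ : C → Bool}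
  {S : A × B → Bool} {R : (A × B) × C → Bool} (m : Matching S e₃ R) (mS : Matching e₁ e₂ S) where

  private
    inS : ∀ {x y z} → R ((x , y) , z) ≡ true → S (x , y) ≡ true
    inS p = proj₁ (within m _ _ p)

  assoc-proj₁-injective : Proj₁Injective (R ∘ assoc)
  assoc-proj₁-injective p p′ refl =
    let y≡y′ = proj₁-injective mS (inS p) (inS p′) refl
    in cong₂ _,_ y≡y′ (proj₁-injective m p p′ (cong₂ _,_ refl y≡y′))

  assoc-proj₂-injective : Proj₂Injective (R ∘ assoc)
  assoc-proj₂-injective p p′ refl = cong proj₁ (proj₂-injective m p p′ refl)

  assoc-within : ∀ x y z → R ((x , y) , z) ≡ true → e₁ x ≡ true
  assoc-within x y z p = proj₁ (within mS x y (inS p))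

  suffix-matching : {N : B × C → Bool} →
    (∀ {y z} → N (y , z) ≡ true → ∃ λ x → R ((x , y) , z) ≡ true) → Matching e₂ e₃ N
  suffix-matching N⁻ = record
    { within          = λ y z p → let (_ , q) = N⁻ p in
                          proj₂ (within mS _ _ (inS q)) , proj₂ (within m _ _ q)
    ; proj₁-injective = λ p p′ y≡y′ → let (_ , q) = N⁻ p ; (_ , q′) = N⁻ p′ in
                          proj₁-injective m q q′
                            (cong₂ _,_ (proj₂-injective mS (inS q) (inS q′) y≡y′) y≡y′)
    ; proj₂-injective = λ p p′ z≡z′ → let (_ , q) = N⁻ p ; (_ , q′) = N⁻ p′ in
                          cong proj₂ (proj₂-injective m q q′ z≡z′)
    }

-- Associativity

module _ (H₁ H₂ H₃ : Hypergraph) where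

  assocʳ-edge : ∀ R → Edge (H₁ ×̲ (H₂ ×̲ H₃)) R → Edge ((H₁ ×̲ H₂) ×̲ H₃) (R ∘ assocʳ′)
  assocʳ-edge R R-edge with edge⇒maximumMatching H₁ (H₂ ×̲ H₃) R-edge
  ... | record { left = e₁ ; right = e₂₃ ; left-edge = e₁-edge ; right-edge = e₂₃-edge
               ; matching = m ; maximum = βR }
    with edge⇒maximumMatching H₂ H₃ e₂₃-edge
  ... | record { left = e₂ ; right = e₃ ; left-edge = e₂-edge ; right-edge = e₃-edge
               ; matching = m₂₃ ; maximum = β₂₃ } =
    regroup (matching-extends-to-edge H₁ H₂ e₁-edge e₂-edge
               (prefix-matching m m₂₃ (proj₁-img⁻ {H₁ ×̲ H₂} {H₃} {R′})) βM |M|≤|e₁|⊓|e₂|)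
    where
    a b c : ℕ
    a = card H₁ e₁
    b = card H₂ e₂
    c = card H₃ e₃

    |e₂₃| : card (H₂ ×̲ H₃) e₂₃ ≡ b ⊓ c
    |e₂₃| = hasSize⇒card (H₂ ×̲ H₃) β₂₃

    R′ : (V H₁ × V H₂) × V H₃ → Bool
    R′ = R ∘ assocʳ′

    βR′ : HasSize R′ (a ⊓ card (H₂ ×̲ H₃) e₂₃)
    βR′ = ↔-trans (Members-∘ (×-assoc 0ℓ _ _ _) R) βR

    M : V H₁ × V H₂ → Bool
    M = proj₁-img (H₁ ×̲ H₂) H₃ R′

    βM : HasSize M (a ⊓ card (H₂ ×̲ H₃) e₂₃)
    βM = ↔-trans (↔-sym (proj₁-img↔ {H₁ ×̲ H₂} {H₃} (assocʳ′-proj₁-injective m m₂₃))) βR′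

    |M|≤|e₁|⊓|e₂| : a ⊓ card (H₂ ×̲ H₃) e₂₃ ≤ a ⊓ b
    |M|≤|e₁|⊓|e₂| = subst (_≤ a ⊓ b) (trans (⊓-assoc a b c) (cong (a ⊓_) (sym |e₂₃|)))
                      (m⊓n≤m (a ⊓ b) c)

    regroup : (∃ λ F → Edge (H₁ ×̲ H₂) F × M ⊆ F × card (H₁ ×̲ H₂) F ≡ a ⊓ b) →
      Edge ((H₁ ×̲ H₂) ×̲ H₃) R′
    regroup (F , F-edge , M⊆F , |F|) = maximumMatching⇒edge (H₁ ×̲ H₂) H₃ record
      { left       = F
      ; right      = e₃
      ; left-edge  = F-edge
      ; right-edge = e₃-edge
      ; matching   = record
        { within          = λ (x , y) z p →
            M⊆F (proj₁-img⁺ {H₁ ×̲ H₂} {H₃} {R′} p) , assocʳ′-within m m₂₃ x y z p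
        ; proj₁-injective = assocʳ′-proj₁-injective m m₂₃
        ; proj₂-injective = assocʳ′-proj₂-injective m m₂₃
        }
      ; maximum    = subst (HasSize R′) |R′| βR′
      }
      where
      |R′| : a ⊓ card (H₂ ×̲ H₃) e₂₃ ≡ card (H₁ ×̲ H₂) F ⊓ c
      |R′| = begin
        a ⊓ card (H₂ ×̲ H₃) e₂₃   ≡⟨ cong (a ⊓_) |e₂₃| ⟩
        a ⊓ (b ⊓ c)             ≡⟨ ⊓-assoc a b c ⟨
        a ⊓ b ⊓ c               ≡⟨ cong (_⊓ c) |F| ⟨
        card (H₁ ×̲ H₂) F ⊓ c    ∎
        where open ≡-Reasoning

  assocˡ-edge : ∀ R → Edge ((H₁ ×̲ H₂) ×̲ H₃) R → Edge (H₁ ×̲ (H₂ ×̲ H₃)) (R ∘ assoc)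
  assocˡ-edge R R-edge with edge⇒maximumMatching (H₁ ×̲ H₂) H₃ R-edge
  ... | record { left = e₁₂ ; right = e₃ ; left-edge = e₁₂-edge ; right-edge = e₃-edge
               ; matching = m ; maximum = βR }
    with edge⇒maximumMatching H₁ H₂ e₁₂-edge
  ... | record { left = e₁ ; right = e₂ ; left-edge = e₁-edge ; right-edge = e₂-edge
               ; matching = m₁₂ ; maximum = β₁₂ } =
    regroup (matching-extends-to-edge H₂ H₃ e₂-edge e₃-edge
               (suffix-matching m m₁₂ (proj₂-img⁻ {H₁} {H₂ ×̲ H₃} {R′})) βN |N|≤|e₂|⊓|e₃|)
    where
    a b c : ℕ
    a = card H₁ e₁
    b = card H₂ e₂
    c = card H₃ e₃

    |e₁₂| : card (H₁ ×̲ H₂) e₁₂ ≡ a ⊓ b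
    |e₁₂| = hasSize⇒card (H₁ ×̲ H₂) β₁₂

    R′ : V H₁ × (V H₂ × V H₃) → Bool
    R′ = R ∘ assoc

    βR′ : HasSize R′ (card (H₁ ×̲ H₂) e₁₂ ⊓ c)
    βR′ = ↔-trans (Members-∘ (↔-sym (×-assoc 0ℓ _ _ _)) R) βR

    N : V H₂ × V H₃ → Bool
    N = proj₂-img H₁ (H₂ ×̲ H₃) R′

    βN : HasSize N (card (H₁ ×̲ H₂) e₁₂ ⊓ c)
    βN = ↔-trans (↔-sym (proj₂-img↔ {H₁} {H₂ ×̲ H₃} (assoc-proj₂-injective m m₁₂))) βR′

    |N|≤|e₂|⊓|e₃| : card (H₁ ×̲ H₂) e₁₂ ⊓ c ≤ b ⊓ c
    |N|≤|e₂|⊓|e₃| = subst (_≤ b ⊓ c) (trans (sym (⊓-assoc a b c)) (cong (_⊓ c) (sym |e₁₂|)))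
                      (m⊓n≤n a (b ⊓ c))

    regroup : (∃ λ G → Edge (H₂ ×̲ H₃) G × N ⊆ G × card (H₂ ×̲ H₃) G ≡ b ⊓ c) →
      Edge (H₁ ×̲ (H₂ ×̲ H₃)) R′
    regroup (G , G-edge , N⊆G , |G|) = maximumMatching⇒edge H₁ (H₂ ×̲ H₃) record
      { left       = e₁
      ; right      = G
      ; left-edge  = e₁-edge
      ; right-edge = G-edge
      ; matching   = record
        { within          = λ x (y , z) p →
            assoc-within m m₁₂ x y z p , N⊆G (proj₂-img⁺ {H₁} {H₂ ×̲ H₃} {R′} p)
        ; proj₁-injective = assoc-proj₁-injective m m₁₂
        ; proj₂-injective = assoc-proj₂-injective m m₁₂
        }
      ; maximum    = subst (HasSize R′) |R′| βR′
      }
      where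
      |R′| : card (H₁ ×̲ H₂) e₁₂ ⊓ c ≡ a ⊓ card (H₂ ×̲ H₃) G
      |R′| = begin
        card (H₁ ×̲ H₂) e₁₂ ⊓ c   ≡⟨ cong (_⊓ c) |e₁₂| ⟩
        a ⊓ b ⊓ c               ≡⟨ ⊓-assoc a b c ⟩
        a ⊓ (b ⊓ c)             ≡⟨ cong (a ⊓_) |G| ⟨
        a ⊓ card (H₂ ×̲ H₃) G    ∎
        where open ≡-Reasoning

proposition3p2 : (H₁ H₂ H₃ : Hypergraph) →
    IsHypergraph H₁ → IsHypergraph H₂ → IsHypergraph H₃ →
    IsIsomorphism (H₁ ×̲ (H₂ ×̲ H₃)) ((H₁ ×̲ H₂) ×̲ H₃) assoc
proposition3p2 H₁ H₂ H₃ _ _ _ = record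
  { f⁻¹       = assocʳ′
  ; inverseˡ  = λ _ → refl
  ; inverseʳ  = λ _ → refl
  ; edge-to   = assocʳ-edge H₁ H₂ H₃
  ; edge-from = assocˡ-edge H₁ H₂ H₃
  }
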